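{- Let $G=(V,E)$ be a $d$-regular digraph with a 1-factorization $F=\{F_i\mid 0\le i<d\}$. Suppose there is an increasing sequence of positive integers $(D_k)$ such that for every pair of vertices $(u,v)$ of $G$ there is a word $\omega(u,v)$ over $\{0,\dots,d-1\}$ with the following properties: (1) the length of $\omega(u,v)$ equals one of the $D_k$; (2) $v$ is a vertex on the walk $u\,\omega(u,v)$; (3) for each fixed $u$, the words $\omega(u,v)$, $v\in V$, are distinct. Let $S$ be the routing scheme consisting of all walks $u\,\omega(u,v)$. Then there exists a routing schedule for $S$ with no waiting and time $\tau\le\sum_k D_k\, d^{D_k-1}$.
   Context: A digraph $G=(V,E)$ (multiple edges allowed) is $d$-regular if every vertex has in-degree and out-degree $d$. A 1-factor is a spanning subgraph in which every vertex has in-degree and out-degree $1$; a 1-factorization $\{F_0,\dots,F_{d-1}\}$ is a partition of $E$ into $d$ 1-factors. For a vertex $u$ and a word $\omega=(c_0,\dots,c_{m-1})$ with $c_j\in\{0,\dots,d-1\}$, $u\omega$ denotes the walk of length $m$ in $G$ that starts at $u$ and at step $j$ traverses the unique out-edge in $F_{c_j}$ of the current vertex. A routing scheme is a collection of walks. A routing schedule of time $\tau$ assigns to every edge-occurrence of every walk a time in $\{1,\dots,\tau\}$ such that along each walk times are strictly increasing and no edge of $G$ is assigned the same time twice. It has no waiting if along each walk the assigned times are consecutive integers. -}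

module Defs where

open import Data.Nat using (ℕ; zero; suc; _+_; _*_; _∸_; _^_; _≤_; _<_)
open import Data.Fin using (Fin; toℕ)
open import Data.List using (List; []; _∷_; length; lookup; map; allFin)
open import Data.Nat.ListAction using (sum)
open import Data.List.Membership.Propositional using (_∈_)
open import Data.Product using (Σ; _×_; _,_; proj₁; proj₂)
open import Relation.Binary.PropositionalEquality using (_≡_)
open import Function.Definitions using (Bijective)

-- A d-regular digraph on vertex set Fin n together with a 1-factorization
-- F_0,…,F_{d-1} is encoded by d maps σ i : Fin n → Fin n, where σ i u is the
-- head of the unique out-edge of u lying in F_i.  The edges of G are exactly
-- the pairs (u , i) (edge of F_i leaving u); multiple edges / loops allowed.
Factors : ℕ → ℕ → Set
Factors n d = Fin d → Fin n → Fin n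

Is1Factorization : ∀ {n d} → Factors n d → Set
Is1Factorization {n} {d} σ = (i : Fin d) → Bijective {A = Fin n} _≡_ _≡_ (σ i)

Edge : ℕ → ℕ → Set
Edge n d = Fin n × Fin d

Word : ℕ → Set
Word d = List (Fin d)

walkVertices : ∀ {n d} → Factors n d → Fin n → Word d → List (Fin n)
walkVertices σ u [] = u ∷ []
walkVertices σ u (c ∷ ω) = u ∷ walkVertices σ (σ c u) ω

walkEdges : ∀ {n d} → Factors n d → Fin n → Word d → List (Edge n d)
walkEdges σ u [] = []
walkEdges σ u (c ∷ ω) = (u , c) ∷ walkEdges σ (σ c u) ω

record RoutingSchedule {n d : ℕ} (σ : Factors n d) {I : Set}
       (walk : I → Fin n × Word d) (τ : ℕ) : Set where
  field
    time : (r : I) → Fin (length (walkEdges σ (proj₁ (walk r)) (proj₂ (walk r)))) → ℕ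
    time-range : ∀ r j → 1 ≤ time r j × time r j ≤ τ
    time-increasing : ∀ r j j' → toℕ j < toℕ j' → time r j < time r j'
    no-conflict : ∀ r r' j j' →
      lookup (walkEdges σ (proj₁ (walk r)) (proj₂ (walk r))) j
        ≡ lookup (walkEdges σ (proj₁ (walk r')) (proj₂ (walk r'))) j' →
      time r j ≡ time r' j' →
      _≡_ {A = Σ I (λ s → Fin (length (walkEdges σ (proj₁ (walk s)) (proj₂ (walk s)))))}
          (r , j) (r' , j')

NoWaiting : ∀ {n d} {σ : Factors n d} {I : Set} {walk : I → Fin n × Word d} {τ : ℕ} →
            RoutingSchedule σ walk τ → Set
NoWaiting {I = I} {walk = walk} S =
  ∀ r j j' → suc (toℕ j) ≡ toℕ j' →
  RoutingSchedule.time S r j' ≡ suc (RoutingSchedule.time S r j)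

boundSum : (d m : ℕ) → (Fin m → ℕ) → ℕ
boundSum d m D = sum (map (λ k → D k * d ^ (D k ∸ 1)) (allFin m))

{-# OPTIONS --safe #-}
-- Call two words shift-equivalent if one arises from the other by adding a constant modulo d
-- to every letter.  A class is determined by the differences of the letters from the first
-- one (the shape), so the words of length L fall into d ^ (L ∸ 1) classes.  All walks whose
-- words lie in one class can depart together: if two of them used the same edge at the same
-- step, their letters there would agree, forcing the shift to be zero; equal words then force
-- equal start vertices (each F_i is a permutation) and equal targets (the words ω(u, ·) are
-- distinct).  Running the classes one after the other, each for D_k steps, takes
-- Σ_k D_k d^(D_k ∸ 1) steps.
module Submission where

open import Defs
open import Algebra.Properties.CommutativeSemigroup using (x∙yz≈y∙xz)
open import Data.Nat using (ℕ; suc; _+_; _*_; _∸_; _^_; _≤_; _<_; z≤n; s≤s; NonZero; >-nonZero)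
open import Data.Nat.Properties
open import Data.Nat.DivMod using (_%_; _mod_; %-distribˡ-+; m%n%n≡m%n; m%n≤n; [m+n]%n≡m%n; [m+kn]%n≡m%n; m<n⇒m%n≡m; n%n≡0)
open import Data.Fin using (Fin; toℕ) renaming (zero to fzero; suc to fsuc)
open import Data.Fin.Properties using (toℕ-injective; toℕ<n; toℕ-fromℕ<)
open import Data.List using (List; []; _∷_; length; lookup; map; tabulate)
open import Data.List.Membership.Propositional using (_∈_)
open import Data.List.Properties using (length-map; map-tabulate; map-injective; ∷-injectiveˡ; ∷-injectiveʳ)
open import Data.Nat.ListAction using (sum)
open import Data.Product using (Σ; _×_; _,_; proj₁; proj₂; ∃)
open import Function using (_∘_)
open import Function.Definitions using (Injective)
open import Relation.Binary.PropositionalEquality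
open import Relation.Nullary using (contradiction)

[m%n+k]%n≡[m+k]%n : ∀ m k n .{{_ : NonZero n}} → (m % n + k) % n ≡ (m + k) % n
[m%n+k]%n≡[m+k]%n m k n = begin
  (m % n + k) % n         ≡⟨ %-distribˡ-+ (m % n) k n ⟩
  (m % n % n + k % n) % n ≡⟨ cong (λ x → (x + k % n) % n) (m%n%n≡m%n m n) ⟩
  (m % n + k % n) % n     ≡⟨ %-distribˡ-+ m k n ⟨
  (m + k) % n             ∎
  where open ≡-Reasoning

[m+k%n]%n≡[m+k]%n : ∀ m k n .{{_ : NonZero n}} → (m + k % n) % n ≡ (m + k) % n
[m+k%n]%n≡[m+k]%n m k n = begin
  (m + k % n) % n         ≡⟨ %-distribˡ-+ m (k % n) n ⟩
  (m % n + k % n % n) % n ≡⟨ cong (λ x → (m % n + x) % n) (m%n%n≡m%n k n) ⟩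
  (m % n + k % n) % n     ≡⟨ %-distribˡ-+ m k n ⟨
  (m + k) % n             ∎
  where open ≡-Reasoning

%-cancelʳ-+ : ∀ {x y} e n .{{_ : NonZero n}} → (x + e) % n ≡ (y + e) % n → x % n ≡ y % n
%-cancelʳ-+ {x} {y} e n eq =
  trans (sym (undo x)) (trans (cong (λ t → (t + (n ∸ e % n)) % n) eq) (undo y))
  where
  undo : ∀ z → ((z + e) % n + (n ∸ e % n)) % n ≡ z % n
  undo z = begin
    ((z + e) % n + (n ∸ e % n)) % n     ≡⟨ cong (λ t → (t + (n ∸ e % n)) % n) ([m+k%n]%n≡[m+k]%n z e n) ⟨
    ((z + e % n) % n + (n ∸ e % n)) % n ≡⟨ [m%n+k]%n≡[m+k]%n (z + e % n) (n ∸ e % n) n ⟩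
    (z + e % n + (n ∸ e % n)) % n       ≡⟨ cong (_% n) (+-assoc z (e % n) (n ∸ e % n)) ⟩
    (z + (e % n + (n ∸ e % n))) % n     ≡⟨ cong (λ t → (z + t) % n) (m+[n∸m]≡n (m%n≤n e n)) ⟩
    (z + n) % n                         ≡⟨ [m+n]%n≡m%n z n ⟩
    z % n                               ∎
    where open ≡-Reasoning

toℕ-%-injective : ∀ {n} {x y : Fin n} .{{_ : NonZero n}} → toℕ x % n ≡ toℕ y % n → x ≡ y
toℕ-%-injective {x = x} {y} eq =
  toℕ-injective (trans (sym (m<n⇒m%n≡m (toℕ<n x))) (trans eq (m<n⇒m%n≡m (toℕ<n y))))

_⊖_ : ∀ {d} → Fin d → Fin d → Fin d
_⊖_ {suc d} x c = (toℕ x + (suc d ∸ toℕ c)) mod suc d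

toℕ-⊖ : ∀ {d} (x c : Fin (suc d)) → toℕ (x ⊖ c) ≡ (toℕ x + (suc d ∸ toℕ c)) % suc d
toℕ-⊖ x c = toℕ-fromℕ< _

x⊖x≡0 : ∀ {d} (x : Fin (suc d)) → x ⊖ x ≡ fzero
x⊖x≡0 {d} x = toℕ-injective (begin
  toℕ (x ⊖ x)                          ≡⟨ toℕ-⊖ x x ⟩
  (toℕ x + (suc d ∸ toℕ x)) % suc d    ≡⟨ cong (_% suc d) (m+[n∸m]≡n (<⇒≤ (toℕ<n x))) ⟩
  suc d % suc d                        ≡⟨ n%n≡0 (suc d) ⟩
  0                                    ∎)
  where open ≡-Reasoning

x⊖x≡y⊖y : ∀ {d} (x y : Fin d) → x ⊖ x ≡ y ⊖ y
x⊖x≡y⊖y {suc d} x y = trans (x⊖x≡0 x) (sym (x⊖x≡0 y))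

⊖-injectiveˡ : ∀ {d} {x y c : Fin d} → x ⊖ c ≡ y ⊖ c → x ≡ y
⊖-injectiveˡ {suc d} {x} {y} {c} eq =
  toℕ-%-injective (%-cancelʳ-+ {toℕ x} {toℕ y} (suc d ∸ toℕ c) (suc d)
    (trans (sym (toℕ-⊖ x c)) (trans (cong toℕ eq) (toℕ-⊖ y c))))

[c+x⊖c]%n≡x%n : ∀ {d} (x c : Fin (suc d)) → (toℕ c + toℕ (x ⊖ c)) % suc d ≡ toℕ x % suc d
[c+x⊖c]%n≡x%n {d} x c = begin
  (a + toℕ (x ⊖ c)) % n        ≡⟨ cong (λ t → (a + t) % n) (toℕ-⊖ x c) ⟩
  (a + (b + (n ∸ a)) % n) % n  ≡⟨ [m+k%n]%n≡[m+k]%n a (b + (n ∸ a)) n ⟩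
  (a + (b + (n ∸ a))) % n      ≡⟨ cong (_% n) (x∙yz≈y∙xz +-commutativeSemigroup a b (n ∸ a)) ⟩
  (b + (a + (n ∸ a))) % n      ≡⟨ cong (λ t → (b + t) % n) (m+[n∸m]≡n (<⇒≤ (toℕ<n c))) ⟩
  (b + n) % n                  ≡⟨ [m+n]%n≡m%n b n ⟩
  b % n                        ∎
  where
  open ≡-Reasoning
  n = suc d
  a = toℕ c
  b = toℕ x

⊖-injectiveʳ : ∀ {d} {x c c' : Fin d} → x ⊖ c ≡ x ⊖ c' → c ≡ c'
⊖-injectiveʳ {suc d} {x} {c} {c'} eq =
  toℕ-%-injective (%-cancelʳ-+ {toℕ c} {toℕ c'} (toℕ (x ⊖ c)) (suc d) (begin
  (toℕ c + toℕ (x ⊖ c)) % suc d    ≡⟨ [c+x⊖c]%n≡x%n x c ⟩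
  toℕ x % suc d                    ≡⟨ [c+x⊖c]%n≡x%n x c' ⟨
  (toℕ c' + toℕ (x ⊖ c')) % suc d  ≡⟨ cong (λ t → (toℕ c' + toℕ t) % suc d) eq ⟨
  (toℕ c' + toℕ (x ⊖ c)) % suc d   ∎))
  where open ≡-Reasoning

m<n⇒o*m+o≤o*n : ∀ o {m n} → m < n → o * m + o ≤ o * n
m<n⇒o*m+o≤o*n o {m} {n} m<n = begin
  o * m + o   ≡⟨ +-comm (o * m) o ⟩
  o + o * m   ≡⟨ *-suc o m ⟨
  o * suc m   ≤⟨ *-monoʳ-≤ o m<n ⟩
  o * n       ∎
  where open ≤-Reasoning

b*i+a-injective : ∀ b {i i' a a'} → a < b → a' < b → b * i + a ≡ b * i' + a' → i ≡ i' × a ≡ a'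
b*i+a-injective b {i} {i'} {a} {a'} a<b a'<b eq =
  *-cancelˡ-≡ i i' b (+-cancelʳ-≡ _ _ _ (trans eq (cong (b * i' +_) (sym a≡a')))) , a≡a'
  where
  instance _ = >-nonZero (≤-<-trans z≤n a<b)
  lowDigit : ∀ {j c} → c < b → (b * j + c) % b ≡ c
  lowDigit {j} {c} c<b = begin
    (b * j + c) % b ≡⟨ cong (_% b) (trans (+-comm (b * j) c) (cong (c +_) (*-comm b j))) ⟩
    (c + j * b) % b ≡⟨ [m+kn]%n≡m%n c j b ⟩
    c % b           ≡⟨ m<n⇒m%n≡m c<b ⟩
    c               ∎
    where open ≡-Reasoning
  a≡a' : a ≡ a'
  a≡a' = trans (sym (lowDigit a<b)) (trans (cong (_% b) eq) (lowDigit a'<b))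

fromDigits : ∀ {d} → List (Fin d) → ℕ
fromDigits []           = 0
fromDigits {d} (x ∷ xs) = d * fromDigits xs + toℕ x

fromDigits-< : ∀ {d} (xs : List (Fin d)) → fromDigits xs < d ^ length xs
fromDigits-< []           = s≤s z≤n
fromDigits-< {d} (x ∷ xs) =
  <-≤-trans (+-monoʳ-< (d * fromDigits xs) (toℕ<n x)) (m<n⇒o*m+o≤o*n d (fromDigits-< xs))

fromDigits-injective : ∀ {d} (xs ys : List (Fin d)) →
                       length xs ≡ length ys → fromDigits xs ≡ fromDigits ys → xs ≡ ys
fromDigits-injective []       []       _   _  = refl
fromDigits-injective {d} (x ∷ xs) (y ∷ ys) len eq
  with high , low ← b*i+a-injective d (toℕ<n x) (toℕ<n y) eq =
  cong₂ _∷_ (toℕ-injective low) (fromDigits-injective xs ys (suc-injective len) high)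

shape : ∀ {d} → Word d → List (Fin d)
shape []      = []
shape (c ∷ w) = map (_⊖ c) w

length-shape : ∀ {d} (w : Word d) → length (shape w) ≡ length w ∸ 1
length-shape []      = refl
length-shape (c ∷ w) = length-map (_⊖ c) w

fromDigits-shape-< : ∀ {d} (w : Word d) → fromDigits (shape w) < d ^ (length w ∸ 1)
fromDigits-shape-< {d} w =
  subst (λ l → fromDigits (shape w) < d ^ l) (length-shape w) (fromDigits-< (shape w))

module _ {n d : ℕ} (σ : Factors n d) where

  length-walkEdges : ∀ u (w : Word d) → length (walkEdges σ u w) ≡ length w
  length-walkEdges u []      = refl
  length-walkEdges u (c ∷ w) = cong suc (length-walkEdges (σ c u) w)

  Collide : ∀ u (w : Word d) → Fin (length (walkEdges σ u w)) →
            ∀ u' (w' : Word d) → Fin (length (walkEdges σ u' w')) → Set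
  Collide u w j u' w' j' = toℕ j ≡ toℕ j' × lookup (walkEdges σ u w) j ≡ lookup (walkEdges σ u' w') j'

  collide⇒⊖-base≡ : ∀ {c c' u u'} (w w' : Word d) {j j'} →
                    map (_⊖ c) w ≡ map (_⊖ c') w' → Collide u w j u' w' j' → c ≡ c'
  collide⇒⊖-base≡ (x ∷ w) (x' ∷ w') {fzero} {fzero} rel (_ , meet) =
    ⊖-injectiveʳ (trans (∷-injectiveˡ rel) (cong (_⊖ _) (sym (cong proj₂ meet))))
  collide⇒⊖-base≡ (x ∷ w) (x' ∷ w') {fsuc j} {fsuc j'} rel (step , meet) =
    collide⇒⊖-base≡ w w' (∷-injectiveʳ rel) (suc-injective step , meet)

  sameShape-collide⇒≡ : ∀ {u u'} (w w' : Word d) {j j'} →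
                        shape w ≡ shape w' → Collide u w j u' w' j' → w ≡ w'
  sameShape-collide⇒≡ (c ∷ w) (c' ∷ w') shape≡ collide
    with refl ← collide⇒⊖-base≡ (c ∷ w) (c' ∷ w') (cong₂ _∷_ (x⊖x≡y⊖y c c') shape≡) collide =
    cong (c ∷_) (map-injective ⊖-injectiveˡ shape≡)

  module _ (σ-injective : ∀ i → Injective _≡_ _≡_ (σ i)) where

    collide⇒start≡ : ∀ {u u'} (w : Word d) {j j'} → Collide u w j u' w j' → u ≡ u'
    collide⇒start≡ (c ∷ w) {fzero}  {fzero}  (_ , meet)    = cong proj₁ meet
    collide⇒start≡ (c ∷ w) {fsuc j} {fsuc j'} (step , meet) =
      σ-injective c (collide⇒start≡ w (suc-injective step , meet))

    sameShape-collide⇒start≡×≡ : ∀ {u u'} (w w' : Word d) {j j'} →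
                                 shape w ≡ shape w' → Collide u w j u' w' j' → u ≡ u' × w ≡ w'
    sameShape-collide⇒start≡×≡ w w' shape≡ collide
      with refl ← sameShape-collide⇒≡ w w' shape≡ collide = collide⇒start≡ w collide , refl

offset : ∀ {m} → (Fin m → ℕ) → Fin m → ℕ
offset s fzero    = 0
offset s (fsuc k) = s fzero + offset (s ∘ fsuc) k

offset-fsuc+ : ∀ {m} (s : Fin (suc m) → ℕ) k {x} →
               offset s (fsuc k) + x ≡ s fzero + (offset (s ∘ fsuc) k + x)
offset-fsuc+ s k {x} = +-assoc (s fzero) (offset (s ∘ fsuc) k) x

offset+≤sum : ∀ {m} (s : Fin m → ℕ) k {x} → x ≤ s k → offset s k + x ≤ sum (tabulate s)
offset+≤sum s fzero    x≤ = ≤-trans x≤ (m≤m+n _ _)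
offset+≤sum s (fsuc k) {x} x≤ = begin
  offset s (fsuc k) + x                 ≡⟨ offset-fsuc+ s k ⟩
  s fzero + (offset (s ∘ fsuc) k + x)   ≤⟨ +-monoʳ-≤ (s fzero) (offset+≤sum (s ∘ fsuc) k x≤) ⟩
  s fzero + sum (tabulate (s ∘ fsuc))   ∎
  where open ≤-Reasoning

s₀≤offset-fsuc+ : ∀ {m} (s : Fin (suc m) → ℕ) k {x} → s fzero ≤ offset s (fsuc k) + x
s₀≤offset-fsuc+ s k = ≤-trans (m≤m+n (s fzero) _) (≤-reflexive (sym (offset-fsuc+ s k)))

offset+-injective : ∀ {m} (s : Fin m → ℕ) k k' {x x'} → x < s k → x' < s k' →
                    offset s k + x ≡ offset s k' + x' → k ≡ k' × x ≡ x'
offset+-injective s fzero    fzero    _   _    eq = refl , eq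
offset+-injective s fzero    (fsuc k') x<  _    eq =
  contradiction x< (≤⇒≯ (≤-trans (s₀≤offset-fsuc+ s k') (≤-reflexive (sym eq))))
offset+-injective s (fsuc k) fzero    _   x'<  eq =
  contradiction x'< (≤⇒≯ (≤-trans (s₀≤offset-fsuc+ s k) (≤-reflexive eq)))
offset+-injective s (fsuc k) (fsuc k') x<  x'<  eq
  with k≡k' , x≡x' ← offset+-injective (s ∘ fsuc) k k' x< x'<
         (+-cancelˡ-≡ (s fzero) _ _ (trans (sym (offset-fsuc+ s k)) (trans eq (offset-fsuc+ s k')))) =
  cong fsuc k≡k' , x≡x'

module _ {n d : ℕ} {σ : Factors n d} {I : Set} (walk : I → Fin n × Word d) where

  private
    edges : I → List (Edge n d)
    edges r = walkEdges σ (proj₁ (walk r)) (proj₂ (walk r))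

    Occurrence : Set
    Occurrence = Σ I (λ r → Fin (length (edges r)))

  scheduleFromDepartures : ∀ τ (departure : I → ℕ) →
    (∀ r → departure r + length (edges r) ≤ τ) →
    (∀ r r' j j' → lookup (edges r) j ≡ lookup (edges r') j' →
       departure r + toℕ j ≡ departure r' + toℕ j' → _≡_ {A = Occurrence} (r , j) (r' , j')) →
    Σ (RoutingSchedule σ walk τ) NoWaiting
  scheduleFromDepartures τ departure fits collision-free = schedule , λ r j j' j+1≡j' →
    cong suc (trans (cong (departure r +_) (sym j+1≡j')) (+-suc (departure r) (toℕ j)))
    where
    schedule : RoutingSchedule σ walk τ
    schedule = record
      { time            = λ r j → suc (departure r + toℕ j)
      ; time-range      = λ r j → s≤s z≤n , ≤-trans (+-monoʳ-< (departure r) (toℕ<n j)) (fits r)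
      ; time-increasing = λ r j j' j<j' → s≤s (+-monoʳ-< (departure r) j<j')
      ; no-conflict     = λ r r' j j' meet same-time →
                            collision-free r r' j j' meet (suc-injective same-time)
      }

module ShiftClassSchedule
  {n d m : ℕ} (σ : Factors n d) (σ-injective : ∀ i → Injective _≡_ _≡_ (σ i))
  (D : Fin m → ℕ) (ω : Fin n → Fin n → Word d)
  (length-ω : ∀ u v → ∃ (λ k → length (ω u v) ≡ D k))
  (ω-injective : ∀ u v v' → ω u v ≡ ω u v' → v ≡ v') where

  Route : Set
  Route = Fin n × Fin n

  word : Route → Word d
  word r = ω (proj₁ r) (proj₂ r)

  route : Route → Fin n × Word d
  route r = proj₁ r , word r

  edges : Route → List (Edge n d)
  edges r = walkEdges σ (proj₁ r) (word r)

  Step : Route → Set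
  Step r = Fin (length (edges r))

  blockSize : Fin m → ℕ
  blockSize k = D k * d ^ (D k ∸ 1)

  block : Route → Fin m
  block r = proj₁ (length-ω (proj₁ r) (proj₂ r))

  shapeIndex : Route → ℕ
  shapeIndex r = fromDigits (shape (word r))

  departure : Route → ℕ
  departure r = offset blockSize (block r) + D (block r) * shapeIndex r

  length-word : ∀ r → length (word r) ≡ D (block r)
  length-word r = proj₂ (length-ω (proj₁ r) (proj₂ r))

  length-edges : ∀ r → length (edges r) ≡ D (block r)
  length-edges r = trans (length-walkEdges σ (proj₁ r) (word r)) (length-word r)

  step<D : ∀ r (j : Step r) → toℕ j < D (block r)
  step<D r j = subst (toℕ j <_) (length-edges r) (toℕ<n j)

  shapeIndex<d^ : ∀ r → shapeIndex r < d ^ (D (block r) ∸ 1)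
  shapeIndex<d^ r =
    subst (λ l → shapeIndex r < d ^ (l ∸ 1)) (length-word r) (fromDigits-shape-< (word r))

  withinBlock : ∀ r (j : Step r) → D (block r) * shapeIndex r + toℕ j < blockSize (block r)
  withinBlock r j =
    <-≤-trans (+-monoʳ-< _ (step<D r j)) (m<n⇒o*m+o≤o*n (D (block r)) (shapeIndex<d^ r))

  departure+-assoc : ∀ r (j : Step r) →
    departure r + toℕ j ≡ offset blockSize (block r) + (D (block r) * shapeIndex r + toℕ j)
  departure+-assoc r j = +-assoc (offset blockSize (block r)) (D (block r) * shapeIndex r) (toℕ j)

  departure+length≤boundSum : ∀ r → departure r + length (edges r) ≤ boundSum d m D
  departure+length≤boundSum r = begin
    departure r + length (edges r)              ≡⟨ cong (departure r +_) (length-edges r) ⟩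
    offset blockSize k + D k * shapeIndex r + D k   ≡⟨ +-assoc (offset blockSize k) _ _ ⟩
    offset blockSize k + (D k * shapeIndex r + D k) ≤⟨ offset+≤sum blockSize k fits ⟩
    sum (tabulate blockSize)                    ≡⟨ cong sum (map-tabulate (λ k → k) blockSize) ⟨
    boundSum d m D                              ∎
    where
    open ≤-Reasoning
    k = block r
    fits : D k * shapeIndex r + D k ≤ blockSize k
    fits = m<n⇒o*m+o≤o*n (D k) (shapeIndex<d^ r)

  sameTime⇒sameStep×sameShape : ∀ r r' (j : Step r) (j' : Step r') →
    departure r + toℕ j ≡ departure r' + toℕ j' → toℕ j ≡ toℕ j' × shape (word r) ≡ shape (word r')
  sameTime⇒sameStep×sameShape r r' j j' same-time
    with k≡k' , inner≡ ← offset+-injective blockSize (block r) (block r')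
                           (withinBlock r j) (withinBlock r' j')
                           (trans (sym (departure+-assoc r j))
                                  (trans same-time (departure+-assoc r' j')))
    with index≡ , step≡ ← b*i+a-injective (D (block r)) (step<D r j)
                            (subst (toℕ j' <_) (cong D (sym k≡k')) (step<D r' j'))
                            (trans inner≡ (cong (λ k → D k * shapeIndex r' + toℕ j') (sym k≡k')))
    = step≡ , fromDigits-injective (shape (word r)) (shape (word r')) length≡ index≡
    where
    length≡ : length (shape (word r)) ≡ length (shape (word r'))
    length≡ = begin
      length (shape (word r))   ≡⟨ length-shape (word r) ⟩
      length (word r) ∸ 1       ≡⟨ cong (_∸ 1) (length-word r) ⟩
      D (block r) ∸ 1           ≡⟨ cong (λ k → D k ∸ 1) k≡k' ⟩
      D (block r') ∸ 1          ≡⟨ cong (_∸ 1) (length-word r') ⟨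
      length (word r') ∸ 1      ≡⟨ length-shape (word r') ⟨
      length (shape (word r'))  ∎
      where open ≡-Reasoning

  collision-free : ∀ r r' (j : Step r) (j' : Step r') → lookup (edges r) j ≡ lookup (edges r') j' →
                   departure r + toℕ j ≡ departure r' + toℕ j' →
                   _≡_ {A = Σ Route Step} (r , j) (r' , j')
  collision-free (u , v) (u' , v') j j' meet same-time
    with step≡ , shape≡ ← sameTime⇒sameStep×sameShape (u , v) (u' , v') j j' same-time
    with refl , ω≡ ← sameShape-collide⇒start≡×≡ σ σ-injective (ω u v) (ω u' v') shape≡ (step≡ , meet)
    with refl ← ω-injective u v v' ω≡
    with refl ← toℕ-injective step≡ = refl

theorem1 : (n d : ℕ) (σ : Factors n d) → Is1Factorization σ →
    (m : ℕ) (D : Fin m → ℕ) →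
    ((k : Fin m) → 1 ≤ D k) →
    ((k k' : Fin m) → toℕ k < toℕ k' → D k < D k') →
    (ω : Fin n → Fin n → Word d) →
    ((u v : Fin n) → ∃ (λ k → length (ω u v) ≡ D k)) →
    ((u v : Fin n) → v ∈ walkVertices σ u (ω u v)) →
    ((u v v' : Fin n) → ω u v ≡ ω u v' → v ≡ v') →
    Σ ℕ (λ τ → τ ≤ boundSum d m D ×
      Σ (RoutingSchedule σ (λ (p : Fin n × Fin n) → proj₁ p , ω (proj₁ p) (proj₂ p)) τ)
        (λ S → NoWaiting S))
theorem1 n d σ σ-1-factorization m D _ _ ω length-ω _ ω-injective =
  boundSum d m D , ≤-refl ,
  scheduleFromDepartures route (boundSum d m D) departure departure+length≤boundSum collision-free
  where open ShiftClassSchedule σ (λ i → proj₁ (σ-1-factorization i)) D ω length-ω ω-injective
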